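{- Let $\mathscr{A} = (Q,\Sigma,\delta)$ be an aperiodically $1$-contracting DFA with $n$ states, and let $W = \{w_1,\ldots,w_n\}\subseteq \Sigma^\star$ be a $1$-contracting collection for $\mathscr{A}$ for which the induced state map $\sigma_W$ is a cyclic permutation on $Q$. Then $\mathscr{A}$ is synchronizing, and there exist synchronizing words of the form $w = w_{i_1}\cdots w_{i_{n-1}}$ with $i_1,\ldots,i_{n-1}\in\{1,\ldots,n\}$.
   Context: A DFA is $\mathscr{A}=(Q,\Sigma,\delta)$ with finite state set $Q$, finite alphabet $\Sigma$ and transition function $\delta:Q\times\Sigma\to Q$, extended to $Q\times\Sigma^\star$ in the usual way, and to subsets by $\delta(S,w)=\{\delta(q,w)\mid q\in S\}$. A word $w$ is synchronizing if $\delta(Q,w)$ is a singleton; $\mathscr{A}$ is synchronizing if such a word exists. For $q\in Q$ and $w\in\Sigma^\star$, $\delta^{ -1}(q,w)=\{p\in Q\mid \delta(p,w)=q\}$. A word $w$ is a $1$-deficient word that excludes $q$ if $\delta(Q,w)=Q\setminus\{q\}$; such a word has exactly one state $q^c$ with $|\delta^{ -1}(q^c,w)|=2$, called its contracting state. A collection $W\subseteq\Sigma^\star$ is a $1$-contracting collection if for every $q\in Q$ it contains exactly one $1$-deficient word excluding $q$; $\mathscr{A}$ is $1$-contracting if such a collection exists. The state map $\sigma_W:Q\to Q$ sends $q$ to the contracting state of the unique word of $W$ excluding $q$. $\mathscr{A}$ is aperiodically $1$-contracting if there is a $1$-contracting collection $W$ with $\sigma_W$ a cyclic permutation of $Q$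 (a single $n$-cycle, $n=|Q|$). -}

module Defs where

open import Data.Nat using (ℕ; suc; _≤_; _∸_)
open import Data.Fin using (Fin; _≟_)
open import Data.List using (List; foldl; length; filter; allFin; concat)
open import Data.Vec using (Vec; toList; map)
open import Data.Product using (Σ; ∃; ∃-syntax; _×_)
open import Relation.Binary.PropositionalEquality using (_≡_; _≢_)
open import Function using (_∘_)

record DFA (n m : ℕ) : Set where
  field
    δ : Fin n → Fin m → Fin n

Word : ℕ → Set
Word m = List (Fin m)

module _ {n m : ℕ} (A : DFA n m) where
  open DFA A

  δ* : Fin n → Word m → Fin n
  δ* = foldl δ

  IsSynchronizing : Word m → Set
  IsSynchronizing w = ∃[ s ] (∀ p → δ* p w ≡ s)

  Synchronizing : Set
  Synchronizing = ∃[ w ] IsSynchronizing w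

  -- δ(Q,w) = Q \ {q}
  Excludes : Word m → Fin n → Set
  Excludes w q = (∀ r → δ* r w ≢ q) × (∀ p → p ≢ q → ∃[ r ] δ* r w ≡ p)

  preimageSize : Fin n → Word m → ℕ
  preimageSize p w = length (filter (λ r → δ* r w ≟ p) (allFin n))

  IsContractingState : Word m → Fin n → Set
  IsContractingState w c = preimageSize c w ≡ 2

  -- W (indexed by the excluded state) is a 1-contracting collection
  IsOneContracting : (Fin n → Word m) → Set
  IsOneContracting W = ∀ q → Excludes (W q) q

iter : {n : ℕ} → (Fin n → Fin n) → ℕ → Fin n → Fin n
iter f 0 x = x
iter f (suc k) x = f (iter f k x)

IsCyclic : {n : ℕ} → (Fin n → Fin n) → Set
IsCyclic {n} σ = ∀ p q → ∃[ k ] iter σ k p ≡ q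

concatWords : {n m k : ℕ} → (Fin n → Word m) → Vec (Fin n) k → Word m
concatWords W is = concat (toList (map W is))

module Submission where

-- Fix a target state s.  For a word u call a state r
-- collapsed if δ(r,u) = s.  We build u = w_{i_j} ⋯ w_{i_1} so that at least
-- j+1 states are collapsed (or u is already synchronizing).  Given u, if some
-- state is not collapsed, cyclicity of σ yields a state p that is not collapsed
-- while σ(p) is.  Prepending w_p, which excludes p and has contracting state
-- σ(p), pulls the collapsed set back to a strictly larger one: every collapsed
-- state differs from p, so it has a preimage, and σ(p) has two.  After n-1
-- steps all n states are collapsed, so u is synchronizing.

open import Defs
open import Data.Nat using (ℕ; zero; suc; _≤_; _∸_; s≤s; z≤n)
open import Data.Nat.Properties using (n<1+n)
open import Data.Fin using (Fin; _≟_; punchOut) renaming (zero to fzero; suc to fsuc)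
open import Data.Fin.Properties using (any?; all?; ¬∀⟶∃¬; punchOut-injective; <⇒notInjective)
open import Data.Vec using ([]; _∷_)
open import Data.List using (List; []; _∷_; _++_; filter; length; allFin)
open import Data.List.Properties using (foldl-++)
open import Data.List.Relation.Unary.All using (All; _∷_)
open import Data.List.Relation.Unary.All.Properties using (all-filter)
open import Data.List.Relation.Unary.AllPairs using (_∷_)
open import Data.List.Relation.Unary.Unique.Propositional using (Unique)
open import Data.List.Relation.Unary.Unique.Propositional.Properties using (allFin⁺; filter⁺)
open import Data.Product using (∃-syntax; _×_; _,_; proj₁; proj₂; Σ)
open import Data.Sum using (_⊎_; inj₁; inj₂)
open import Relation.Nullary using (¬_; yes; no; Dec; contradiction)
open import Relation.Binary.Definitions using (DecidableEquality)
open import Relation.Binary.PropositionalEquality using (_≡_; _≢_; refl; sym; trans; cong; subst)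
open import Function using (_∘_)
open import Function.Definitions using (Injective)

-- An injective endomap of a finite set is onto: a missed point x would let
-- us punch x out and inject Fin (suc n) into Fin n.
injective⇒onto : ∀ {n} (g : Fin n → Fin n) → Injective _≡_ _≡_ g → ∀ x → ∃[ i ] g i ≡ x
injective⇒onto {suc n} g g-inj x with any? (λ i → g i ≟ x)
... | yes hit = hit
... | no miss = contradiction (λ {i} {j} → punched-injective {i} {j}) (<⇒notInjective (n<1+n n))
  where
  x≢g : ∀ i → x ≢ g i
  x≢g i x≡gi = miss (i , sym x≡gi)

  punched : Fin (suc n) → Fin n
  punched i = punchOut (x≢g i)

  punched-injective : Injective _≡_ _≡_ punched
  punched-injective eq = g-inj (punchOut-injective (x≢g _) (x≢g _) eq)

pair-avoids : ∀ {A : Set} {P : A → Set} → DecidableEquality A → (a : A) (xs : List A) →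
  Unique xs → All P xs → length xs ≡ 2 → ∃[ b ] (b ≢ a × P b)
pair-avoids _≟ₐ_ a (x ∷ y ∷ []) ((x≢y ∷ _) ∷ _) (px ∷ py ∷ _) refl with x ≟ₐ a
... | yes refl = y , (λ y≡x → x≢y (sym y≡x)) , py
... | no x≢a = x , x≢a , px

preimages : ∀ {n} (f : Fin n → Fin n) (c : Fin n) → List (Fin n)
preimages {n} f c = filter (λ x → f x ≟ c) (allFin n)

second-preimage : ∀ {n} (f : Fin n → Fin n) {c : Fin n} → length (preimages f c) ≡ 2 →
  ∀ a → ∃[ b ] (b ≢ a × f b ≡ c)
second-preimage {n} f {c} two a =
  pair-avoids _≟_ a (preimages f c) (filter⁺ (λ x → f x ≟ c) (allFin⁺ n))
    (all-filter (λ x → f x ≟ c) (allFin n)) two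

crossing : ∀ {n} (σ : Fin n → Fin n) {S : Fin n → Set} → (∀ x → Dec (S x)) →
  ∀ k {x} → ¬ S x → S (iter σ k x) → ∃[ p ] (¬ S p × S (σ p))
crossing σ S? zero ¬Sx Sx = contradiction Sx ¬Sx
crossing σ S? (suc k) {x} ¬Sx Sσᵏ⁺¹x with S? (iter σ k x)
... | yes Sσᵏx = crossing σ S? k ¬Sx Sσᵏx
... | no ¬Sσᵏx = iter σ k x , ¬Sσᵏx , Sσᵏ⁺¹x

HasAtLeast : ∀ {n} → ℕ → (Fin n → Set) → Set
HasAtLeast {n} k S = Σ (Fin k → Fin n) λ g → Injective _≡_ _≡_ g × (∀ i → S (g i))

HasAtLeast-mono : ∀ {n k} {S T : Fin n → Set} → (∀ x → S x → T x) → HasAtLeast k S → HasAtLeast k T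
HasAtLeast-mono S⊆T (g , g-inj , Sg) = g , g-inj , λ i → S⊆T (g i) (Sg i)

HasAtLeast-all : ∀ {n} {S : Fin n → Set} → HasAtLeast n S → ∀ x → S x
HasAtLeast-all {S = S} (g , g-inj , Sg) x with injective⇒onto g g-inj x
... | i , refl = Sg i

-- If S avoids p and contains c, then the preimage f⁻¹(S) has at least one
-- more element than S: each state of S has a preimage, and c a second one.
pullback-grows : ∀ {n k} (f : Fin n → Fin n) {p c : Fin n} {S : Fin n → Set} →
  (∀ y → y ≢ p → ∃[ x ] f x ≡ y) → length (preimages f c) ≡ 2 →
  ¬ S p → S c → HasAtLeast k S → HasAtLeast (suc k) (S ∘ f)
pullback-grows {n} {k} f {p} {c} {S} onto two ¬Sp Sc (g , g-inj , Sg) = g′ , g′-inj , Sfg′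
  where
  -- a chosen preimage of every state except p (p itself is sent anywhere)
  section : Fin n → Fin n
  section y with y ≟ p
  ... | yes _ = y
  ... | no y≢p = proj₁ (onto y y≢p)

  section-spec : ∀ y → y ≢ p → f (section y) ≡ y
  section-spec y y≢p with y ≟ p
  ... | yes y≡p = contradiction y≡p y≢p
  ... | no y≢p′ = proj₂ (onto y y≢p′)

  S⇒≢p : ∀ {y} → S y → y ≢ p
  S⇒≢p Sy refl = ¬Sp Sy

  f-section-g : ∀ i → f (section (g i)) ≡ g i
  f-section-g i = section-spec (g i) (S⇒≢p (Sg i))

  extra : Fin n
  extra = proj₁ (second-preimage f two (section c))

  extra≢section : extra ≢ section c
  extra≢section = proj₁ (proj₂ (second-preimage f two (section c)))

  f-extra : f extra ≡ c
  f-extra = proj₂ (proj₂ (second-preimage f two (section c)))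

  g′ : Fin (suc k) → Fin n
  g′ fzero = extra
  g′ (fsuc i) = section (g i)

  Sfg′ : ∀ i → S (f (g′ i))
  Sfg′ fzero = subst S (sym f-extra) Sc
  Sfg′ (fsuc i) = subst S (sym (f-section-g i)) (Sg i)

  -- if the extra preimage coincided with some section (g i), then g i = c,
  -- so that section would be section c, which extra avoids
  extra-new : ∀ i → extra ≢ section (g i)
  extra-new i eq = extra≢section (trans eq (cong section gi≡c))
    where
    gi≡c : g i ≡ c
    gi≡c = trans (sym (f-section-g i)) (trans (cong f (sym eq)) f-extra)

  g′-inj : Injective _≡_ _≡_ g′
  g′-inj {fzero} {fzero} _ = refl
  g′-inj {fzero} {fsuc j} eq = contradiction eq (extra-new j)
  g′-inj {fsuc i} {fzero} eq = contradiction (sym eq) (extra-new i)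
  g′-inj {fsuc i} {fsuc j} eq =
    cong fsuc (g-inj (trans (sym (f-section-g i)) (trans (cong f eq) (f-section-g j))))

prepend-synchronizing : ∀ {n m} (A : DFA n m) (v u : Word m) →
  IsSynchronizing A u → IsSynchronizing A (v ++ u)
prepend-synchronizing A v u (s , sync) = s , λ r → trans (foldl-++ (DFA.δ A) r v u) (sync _)

module Collapse {n m : ℕ} (A : DFA n m) (W : Fin n → Word m)
  (one-contracting : IsOneContracting A W) (σ : Fin n → Fin n)
  (contracting : ∀ q → IsContractingState A (W q) (σ q)) (cyclic : IsCyclic σ)
  (s : Fin n) where

  Collapsed : Word m → Fin n → Set
  Collapsed u r = δ* A r u ≡ s

  Collapsed? : ∀ u r → Dec (Collapsed u r)
  Collapsed? u r = δ* A r u ≟ s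

  Progress : ℕ → Set
  Progress j = ∃[ is ] (IsSynchronizing A (concatWords W is)
                        ⊎ HasAtLeast (suc j) (Collapsed (concatWords {k = j} W is)))

  start : Progress 0
  start = [] , inj₂ ((λ _ → s) , (λ {i} {j} _ → single i j) , (λ _ → refl))
    where
    single : (i j : Fin 1) → i ≡ j
    single fzero fzero = refl

  grow : ∀ {k} u p → ¬ Collapsed u p → Collapsed u (σ p) →
    HasAtLeast k (Collapsed u) → HasAtLeast (suc k) (Collapsed (W p ++ u))
  grow u p ¬Cp Cσp C≥k =
    HasAtLeast-mono (λ r Cr → trans (foldl-++ (DFA.δ A) r (W p) u) Cr)
      (pullback-grows (λ r → δ* A r (W p)) (proj₂ (one-contracting p)) (contracting p) ¬Cp Cσp C≥k)

  extend : ∀ {k} u → HasAtLeast (suc k) (Collapsed u) →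
    IsSynchronizing A u ⊎ ∃[ p ] HasAtLeast (suc (suc k)) (Collapsed (W p ++ u))
  extend u C≥k@(g , _ , Cg) with all? (Collapsed? u)
  ... | yes all = inj₁ (s , all)
  ... | no ¬all with ¬∀⟶∃¬ n _ (Collapsed? u) ¬all
  ...   | q , ¬Cq with cyclic q (g fzero)
  ...     | k , σᵏq≡g₀ with crossing σ (Collapsed? u) k ¬Cq
                              (subst (Collapsed u) (sym σᵏq≡g₀) (Cg fzero))
  ...       | p , ¬Cp , Cσp = inj₂ (p , grow u p ¬Cp Cσp C≥k)

  step : ∀ j → Progress j → Progress (suc j)
  step j (is , inj₁ sync) = (s ∷ is) , inj₁ (prepend-synchronizing A (W s) _ sync)
  step j (is , inj₂ C≥j) with extend (concatWords W is) C≥j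
  ... | inj₁ sync = (s ∷ is) , inj₁ (prepend-synchronizing A (W s) _ sync)
  ... | inj₂ (p , C≥j+1) = (p ∷ is) , inj₂ C≥j+1

  progress : ∀ j → Progress j
  progress zero = start
  progress (suc j) = step j (progress j)

  synchronized : ∀ {n′} → n ≡ suc n′ → ∃[ is ] IsSynchronizing A (concatWords {k = n′} W is)
  synchronized {n′} refl with progress n′
  ... | is , inj₁ sync = is , sync
  ... | is , inj₂ C≥n = is , s , HasAtLeast-all C≥n

corollary1 : (n m : ℕ) → 1 ≤ n → (A : DFA n m) → (W : Fin n → Word m) →
    IsOneContracting A W → (σ : Fin n → Fin n) →
    (∀ q → IsContractingState A (W q) (σ q)) → IsCyclic σ →
    Synchronizing A × ∃[ is ] IsSynchronizing A (concatWords {n} {m} {n ∸ 1} W is)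
corollary1 (suc n′) m (s≤s z≤n) A W one-contracting σ contracting cyclic =
  (concatWords W (proj₁ word) , proj₂ word) , word
  where
  word : ∃[ is ] IsSynchronizing A (concatWords {k = n′} W is)
  word = Collapse.synchronized A W one-contracting σ contracting cyclic fzero refl
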